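{- Let $r,s$ be coprime positive integers, $c$ a positive integer, and $k=rsk_1$ where $k_1$ is a positive integer divisible by $c$. Then $M_{r,s,c}(\lambda_{r,s,k})$ has a unique $(r,s,c)$-tour; equivalently, if $\mu$ is a partition with $M_{r,s,c}(\mu)=M_{r,s,c}(\lambda_{r,s,k})$, then $\mu=\lambda_{r,s,k}$.
   Context: $\lambda_{r,s,k}$ is the partition whose Young diagram consists of all unit boxes whose top right corner $(x,y)$ satisfies $sx+ry\le k$. For a partition $\lambda$ (with $\lambda_i=0$ beyond its length $\ell$), the boundary graph $b(\lambda)$ has, for integers $x,y\ge0$, a south edge $(x,y+1)\to(x,y)$ if either $x=0$ and $y\ge\ell$, or $x>0$ and $\lambda_{y+1}=x$, and an east edge $(x,y)\to(x+1,y)$ if either $y=0$ and $x\ge\lambda_1$, or $y>0$ and $\lambda_{y+1}\le x<\lambda_y$; ordering its edges by the value $x-y$ at their targets gives the boundary tour. $M_{r,s,c}(\lambda)$ is obtained from $b(\lambda)$ by identifying $(x_1,y_1),(x_2,y_2)$ whenever $sx_1+ry_1=sx_2+ry_2$ and $x_1-y_1\equiv x_2-y_2\pmod c$, edges keeping their South/East labels; equality means equal vertex sets and equal numbers of edges of each label between each ordered pair of vertices. An $(r,s,c)$-tour of a multigraph $M$ is the image in $M$ of the boundary tour of a partition $\lambda$ with $M_{r,s,c}(\lambda)=M$ (the boundary, hence $\lambda$, is recovered from its tour). -}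

module Defs where

open import Data.Bool using (Bool; true; false; _∧_; _∨_; if_then_else_)
open import Data.Nat using (ℕ; zero; suc; _+_; _*_; _≤_; _<_; _≤ᵇ_; _<ᵇ_; _≡ᵇ_; NonZero)
open import Data.Nat.Divisibility using (_∣_)
open import Data.Nat.Coprimality using (Coprime)
open import Data.Integer using (ℤ; +_; _-_; _%ℕ_)
open import Data.List using (List; []; _∷_; length; map; filter; upTo; concatMap)
open import Data.List.Relation.Unary.All using (All)
open import Data.List.Relation.Unary.Linked using (Linked)
open import Data.Product using (Σ; _×_; _,_; proj₁)
open import Data.Unit using (⊤)
open import Function.Bundles using (_⇔_)
open import Relation.Binary.PropositionalEquality using (_≡_)
open import Relation.Nullary.Decidable using (⌊_⌋; does)
open import Data.Nat.Properties using (_≤?_)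

IsPartition : List ℕ → Set
IsPartition μ = All (0 <_) μ × Linked (λ a b → b ≤ a) μ

-- part μ y = λ_{y+1}  (0-indexed access; 0 beyond the length ℓ)
part : List ℕ → ℕ → ℕ
part []       _       = 0
part (a ∷ _)  zero    = a
part (_ ∷ μ)  (suc y) = part μ y

-- λ_{r,s,k}: row i (i ≥ 1) consists of the boxes whose top-right corner
-- (j , i), j ≥ 1, satisfies s j + r i ≤ k.  For r , s ≥ 1 only j , i ≤ k
-- can occur, so we enumerate 1..k.

count : {A : Set} → (A → Bool) → List A → ℕ
count p xs = length (filter (λ a → Data.Bool._≟_ (p a) true) xs)
  where import Data.Bool

oneTo : ℕ → List ℕ
oneTo k = map suc (upTo k)

lamRow : ℕ → ℕ → ℕ → ℕ → ℕ
lamRow r s k i = count (λ j → (s * j + r * i) ≤ᵇ k) (oneTo k)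

lam : ℕ → ℕ → ℕ → List ℕ
lam r s k = filter (λ n → 1 ≤? n) (map (lamRow r s k) (oneTo k))

-- Boundary graph b(μ).
-- southE μ x y : there is a south edge (x , y+1) → (x , y)
-- eastE  μ x y : there is an east  edge (x , y)   → (x+1 , y)

southE : List ℕ → ℕ → ℕ → Bool
southE μ zero    y = length μ ≤ᵇ y
southE μ (suc x) y = part μ y ≡ᵇ suc x

eastE : List ℕ → ℕ → ℕ → Bool
eastE μ x zero    = part μ 0 ≤ᵇ x
eastE μ x (suc y) = (part μ (suc y) ≤ᵇ x) ∧ (x <ᵇ part μ y)

vertexB : List ℕ → ℕ → ℕ → Bool
vertexB μ x y = southE μ x y ∨ eastE μ x y ∨ srcS y ∨ tgtE x
  where
  srcS : ℕ → Bool        -- source of the south edge (x , y) → (x , y-1)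
  srcS zero    = false
  srcS (suc y') = southE μ x y'
  tgtE : ℕ → Bool        -- target of the east edge (x-1 , y) → (x , y)
  tgtE zero    = false
  tgtE (suc x') = eastE μ x' y

-- The quotient M_{r,s,c}(μ).  Two lattice points are identified iff they
-- have the same key (s x + r y , (x - y) mod c); so vertices of M are
-- (represented by) keys.

Key : Set
Key = ℕ × ℕ

key : (r s c : ℕ) .{{_ : NonZero c}} → ℕ → ℕ → Key
key r s c x y = (s * x + r * y , (+ x - + y) %ℕ c)

_≡ᴷ_ : Key → Key → Bool
(a , b) ≡ᴷ (a' , b') = (a ≡ᵇ a') ∧ (b ≡ᵇ b')

-- all lattice points (x , y) with x , y ≤ v  (this contains every point
-- with s x + r y = v when r , s ≥ 1)
box : ℕ → List (ℕ × ℕ)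
box v = concatMap (λ x → map (λ y → (x , y)) (upTo (suc v))) (upTo (suc v))

MVertex : (r s c : ℕ) .{{_ : NonZero c}} → List ℕ → Key → Set
MVertex r s c μ K =
  Σ ℕ λ x → Σ ℕ λ y → (vertexB μ x y ≡ true) × (key r s c x y ≡ K)

southCount : (r s c : ℕ) .{{_ : NonZero c}} → List ℕ → Key → Key → ℕ
southCount r s c μ K₁ K₂ =
  count (λ { (x , y) → southE μ x y ∧ (key r s c x (suc y) ≡ᴷ K₁)
                                   ∧ (key r s c x y ≡ᴷ K₂) })
        (box (proj₁ K₁))

eastCount : (r s c : ℕ) .{{_ : NonZero c}} → List ℕ → Key → Key → ℕ
eastCount r s c μ K₁ K₂ =
  count (λ { (x , y) → eastE μ x y ∧ (key r s c x y ≡ᴷ K₁)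
                                  ∧ (key r s c (suc x) y ≡ᴷ K₂) })
        (box (proj₁ K₁))

SameM : (r s c : ℕ) .{{_ : NonZero c}} → List ℕ → List ℕ → Set
SameM r s c μ ν =
  (∀ K → MVertex r s c μ K ⇔ MVertex r s c ν K)
  × (∀ K₁ K₂ → southCount r s c μ K₁ K₂ ≡ southCount r s c ν K₁ K₂)
  × (∀ K₁ K₂ → eastCount r s c μ K₁ K₂ ≡ eastCount r s c ν K₁ K₂)

-- Identified vertices share their level s x + r y, and levels alone already pin μ down.  Under
-- every box outside μ runs an east edge of μ; it is matched by an east edge of λ = λ_{r,s,k} at the
-- same level, and east edges of λ lie above level k, so no box outside μ lies in λ.  Conversely, a
-- box of μ above level k can be traded for one of strictly higher level: move right inside its
-- row or, at the end of the row, follow its south edge into λ.  A south edge of λ above level k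
-- lies on the axis x = 0, where its level determines it.  Were the matching row of μ empty, μ
-- would have that edge besides its own, two edges where λ has one; so the row is non-empty and
-- its first box is higher.  Levels of boxes of μ are bounded, so μ has no box above level k.
module Submission where

open import Defs
open import Data.Nat using (ℕ; _*_; _<_; NonZero)
open import Data.Nat.Divisibility using (_∣_)
open import Data.Nat.Coprimality using (Coprime)
open import Data.List using (List)
open import Relation.Binary.PropositionalEquality using (_≡_)

open import Data.Bool using (Bool; true; false; T; _∧_)
open import Data.Bool.Properties using (T-≡; T-∧)
open import Data.Empty using (⊥-elim)
open import Data.Nat using (zero; suc; _+_; _≤_; z≤n; s≤s; z<s; _≤ᵇ_; >-nonZero)
open import Data.Nat.Properties
open import Data.Nat.Tactic.RingSolver using (solve-∀)
open import Data.List
  using ([]; _∷_; length; map; filter; upTo; applyUpTo; concatMap; cartesianProduct; _++_)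
open import Data.List.Properties using (map-∘; map-upTo)
open import Data.List.Membership.Propositional using (_∈_)
open import Data.List.Membership.Propositional.Properties
  using (∈-filter⁺; ∈-filter⁻; ∈-cartesianProduct⁺; ∈-upTo⁺; ∈-length)
open import Data.List.Relation.Unary.Any using (here; there)
open import Data.List.Relation.Unary.All using (All; _∷_)
open import Data.List.Relation.Unary.All.Properties using (all-filter)
open import Data.List.Relation.Unary.AllPairs using (_∷_)
open import Data.List.Relation.Unary.Linked using (Linked; []; [-]; _∷_; tail)
open import Data.List.Relation.Unary.Linked.Properties using (applyUpTo⁺₂)
open import Data.List.Relation.Unary.Unique.Propositional using (Unique)
import Data.List.Relation.Unary.Unique.Propositional.Properties as Unique
open import Data.Product using (_×_; _,_; proj₁; proj₂; ∃-syntax; ∃₂; uncurry)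
open import Function using (_∘_; flip)
open import Function.Bundles using (_⇔_; mk⇔; Equivalence)
open import Function.Construct.Composition using (_⇔-∘_)
open import Relation.Nullary using (¬_; yes; no)
open import Relation.Binary.PropositionalEquality
  using (_≢_; refl; sym; trans; cong; cong₂; subst; module ≡-Reasoning)

open Equivalence using (to; from)

no-endless-ascent : ∀ {A : Set} (P : A → Set) (f : A → ℕ) (B : ℕ) → (∀ {a} → P a → f a ≤ B) →
                    (∀ {a} → P a → ∃[ b ] P b × f a < f b) → ∀ {a} → ¬ P a
no-endless-ascent P f B bounded ascend {a} Pa =
  <-irrefl refl (≤-trans (m≤n+m (suc B) (f a)) (room (suc B) Pa))
  where
  room : ∀ n {a} → P a → f a + n ≤ B
  room zero    {a} Pa = ≤-trans (≤-reflexive (+-identityʳ (f a))) (bounded Pa)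
  room (suc n) {a} Pa = let b , Pb , fa<fb = ascend Pa in
    ≤-trans (≤-reflexive (+-suc (f a) n)) (≤-trans (+-monoˡ-≤ n fa<fb) (room n Pb))

∀<⇒≤ : ∀ {m n} → (∀ {x} → x < m → x < n) → m ≤ n
∀<⇒≤ below = ≮⇒≥ (λ n<m → <-irrefl refl (below n<m))

length≥2 : ∀ {A : Set} {x z : A} {ys} → x ∈ ys → z ∈ ys → x ≢ z → 2 ≤ length ys
length≥2 (here refl) (here refl) x≢z = ⊥-elim (x≢z refl)
length≥2 (here refl) (there z∈) _    = s≤s (∈-length z∈)
length≥2 (there x∈)  (here refl) _   = s≤s (∈-length x∈)
length≥2 (there x∈)  (there z∈) x≢z  = m≤n⇒m≤1+n (length≥2 x∈ z∈ x≢z)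

unique-constant⇒length≤1 : ∀ {A : Set} {ys : List A} → Unique ys →
                           (∀ {a b} → a ∈ ys → b ∈ ys → a ≡ b) → length ys ≤ 1
unique-constant⇒length≤1 {ys = []}         _               _     = z≤n
unique-constant⇒length≤1 {ys = _ ∷ []}     _               _     = s≤s z≤n
unique-constant⇒length≤1 {ys = _ ∷ _ ∷ _} ((a≢b ∷ _) ∷ _) equal =
  ⊥-elim (a≢b (equal (here refl) (there (here refl))))

module _ {A : Set} (p : A → Bool) where

  private
    ∈-holds⁺ : ∀ {x xs} → x ∈ xs → T (p x) → x ∈ filter (λ a → Data.Bool._≟_ (p a) true) xs
    ∈-holds⁺ x∈ px = ∈-filter⁺ _ x∈ (to T-≡ px)

    ∈-holds⁻ : ∀ {x xs} → x ∈ filter (λ a → Data.Bool._≟_ (p a) true) xs → x ∈ xs × T (p x)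
    ∈-holds⁻ x∈ = let x∈xs , px = ∈-filter⁻ _ x∈ in x∈xs , from T-≡ px

    nonempty⇒∈ : ∀ {ys : List A} → 0 < length ys → ∃[ y ] y ∈ ys
    nonempty⇒∈ {y ∷ _} _ = y , here refl

  count-witness : ∀ xs → 0 < count p xs → ∃[ x ] x ∈ xs × T (p x)
  count-witness xs pos = let x , x∈ = nonempty⇒∈ pos in x , ∈-holds⁻ x∈

  count-≥1 : ∀ {x xs} → x ∈ xs → T (p x) → 1 ≤ count p xs
  count-≥1 x∈ px = ∈-length (∈-holds⁺ x∈ px)

  count-≥2 : ∀ {x z xs} → x ∈ xs → z ∈ xs → x ≢ z → T (p x) → T (p z) → 2 ≤ count p xs
  count-≥2 x∈ z∈ x≢z px pz = length≥2 (∈-holds⁺ x∈ px) (∈-holds⁺ z∈ pz) x≢z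

  count-≤1 : ∀ {xs} → Unique xs → (∀ {x z} → x ∈ xs → z ∈ xs → T (p x) → T (p z) → x ≡ z) →
             count p xs ≤ 1
  count-≤1 unique equal = unique-constant⇒length≤1 (Unique.filter⁺ _ unique) λ a∈ b∈ →
    let a∈xs , pa = ∈-holds⁻ a∈ ; b∈xs , pb = ∈-holds⁻ b∈ in equal a∈xs b∈xs pa pb

count-map : ∀ {A B : Set} (p : B → Bool) (f : A → B) xs → count p (map f xs) ≡ count (p ∘ f) xs
count-map p f []       = refl
count-map p f (x ∷ xs) with p (f x)
... | true  = cong suc (count-map p f xs)
... | false = count-map p f xs

DownClosed : (ℕ → Bool) → Set
DownClosed P = ∀ j → T (P (suc j)) → T (P j)

downClosed⇒zero : ∀ {P} → DownClosed P → ∀ {x} → T (P x) → T (P 0)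
downClosed⇒zero closed {zero}  Px = Px
downClosed⇒zero closed {suc x} Px = downClosed⇒zero closed (closed x Px)

count-upTo-suc : ∀ (P : ℕ → Bool) n → count P (upTo (suc n)) ≡ count P (0 ∷ map suc (upTo n))
count-upTo-suc P n = cong (λ xs → count P (0 ∷ xs)) (sym (map-upTo suc n))

count-upTo-downClosed : ∀ n (P : ℕ → Bool) → DownClosed P → (∀ {j} → T (P j) → j < n) →
                        ∀ x → x < count P (upTo n) ⇔ T (P x)
count-upTo-downClosed zero P closed bounded x = mk⇔ (λ ()) (λ Px → ⊥-elim (n≮0 (bounded Px)))
count-upTo-downClosed (suc n) P closed bounded x
  rewrite count-upTo-suc P n
  with P 0 in P0
... | true rewrite count-map P suc (upTo n) = shifted x
  where
  shifted : ∀ x → x < suc (count (P ∘ suc) (upTo n)) ⇔ T (P x)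
  shifted zero    = mk⇔ (λ _ → from T-≡ P0) (λ _ → s≤s z≤n)
  shifted (suc x) = let IH = count-upTo-downClosed n (P ∘ suc) (closed ∘ suc) (≤-pred ∘ bounded) x
                    in mk⇔ (to IH ∘ ≤-pred) (s≤s ∘ from IH)
... | false rewrite count-map P suc (upTo n) = mk⇔ (λ x< → absurd (closed x (to IH x<))) absurd
  where
  IH = count-upTo-downClosed n (P ∘ suc) (closed ∘ suc) (≤-pred ∘ bounded) x
  absurd : ∀ {A : Set} → T (P x) → A
  absurd Px with () ← trans (sym P0) (to T-≡ (downClosed⇒zero closed Px))

part-≤-head : ∀ {xs} → Linked (flip _≤_) xs → ∀ y → part xs y ≤ part xs 0
part-≤-head []                  _       = z≤n
part-≤-head [-]                 zero    = ≤-refl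
part-≤-head [-]                 (suc y) = z≤n
part-≤-head (_ ∷ _)             zero    = ≤-refl
part-≤-head (x≥x' ∷ linked)     (suc y) = ≤-trans (part-≤-head linked y) x≥x'

part-pos⇒<length : ∀ xs {y} → 0 < part xs y → y < length xs
part-pos⇒<length (_ ∷ _)  {zero}  _   = s≤s z≤n
part-pos⇒<length (_ ∷ xs) {suc y} pos = s≤s (part-pos⇒<length xs pos)

<length⇒part-pos : ∀ {xs y} → All (0 <_) xs → y < length xs → 0 < part xs y
<length⇒part-pos {y = zero}  (pos ∷ _)  _ = pos
<length⇒part-pos {y = suc y} (_ ∷ allPos) (s≤s y<) = <length⇒part-pos allPos y<

part-injective : ∀ {xs ys} → All (0 <_) xs → All (0 <_) ys →
                 (∀ y → part xs y ≡ part ys y) → xs ≡ ys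
part-injective {[]}     {[]}     _          _          _     = refl
part-injective {[]}     {_ ∷ _}  _          (pos ∷ _)  parts = ⊥-elim (<-irrefl (parts 0) pos)
part-injective {_ ∷ _}  {[]}     (pos ∷ _)  _          parts = ⊥-elim (<-irrefl (sym (parts 0)) pos)
part-injective {_ ∷ _}  {_ ∷ _}  (_ ∷ xs⁺)  (_ ∷ ys⁺)  parts =
  cong₂ _∷_ (parts 0) (part-injective xs⁺ ys⁺ (parts ∘ suc))

part-filter-positive : ∀ {xs} → Linked (flip _≤_) xs → ∀ y →
                       part (filter (λ n → 1 ≤? n) xs) y ≡ part xs y
part-filter-positive {[]}        _      _       = refl
part-filter-positive {suc _ ∷ _} _      zero    = refl
part-filter-positive {suc _ ∷ _} linked (suc y) = part-filter-positive (tail linked) y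
part-filter-positive {zero ∷ xs} linked y       = begin
  part (filter (λ n → 1 ≤? n) xs) y ≡⟨ part-filter-positive (tail linked) y ⟩
  part xs y                         ≡⟨ n≤0⇒n≡0 (part-≤-head linked (suc y)) ⟩
  0                                 ≡⟨ sym (n≤0⇒n≡0 (part-≤-head linked y)) ⟩
  part (zero ∷ xs) y                ∎
  where open ≡-Reasoning

part-applyUpTo : ∀ (g : ℕ → ℕ) n → (∀ {y} → n ≤ y → g y ≡ 0) → ∀ y → part (applyUpTo g n) y ≡ g y
part-applyUpTo g zero    vanish y       = sym (vanish z≤n)
part-applyUpTo g (suc n) vanish zero    = refl
part-applyUpTo g (suc n) vanish (suc y) = part-applyUpTo (g ∘ suc) n (vanish ∘ s≤s) y

eastE⇒part≤ : ∀ μ {x} y → T (eastE μ x y) → part μ y ≤ x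
eastE⇒part≤ μ zero    e = ≤ᵇ⇒≤ _ _ e
eastE⇒part≤ μ (suc y) e = ≤ᵇ⇒≤ _ _ (proj₁ (to T-∧ e))

east-edge-at-or-above : ∀ μ {x} y → part μ y ≤ x → ∃[ y' ] y' ≤ y × T (eastE μ x y')
east-edge-at-or-above μ zero    part≤x = 0 , z≤n , ≤⇒≤ᵇ part≤x
east-edge-at-or-above μ {x} (suc y) part≤x with x <? part μ y
... | yes x<part = suc y , ≤-refl , from T-∧ (≤⇒≤ᵇ part≤x , <⇒<ᵇ x<part)
... | no  x≮part = let y' , y'≤y , e = east-edge-at-or-above μ y (≮⇒≥ x≮part)
                   in y' , m≤n⇒m≤1+n y'≤y , e

module Staircase (r s k : ℕ) (r>0 : 0 < r) (s>0 : 0 < s) where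

  row : ℕ → ℕ
  row = lamRow r s k

  row-spec : ∀ i x → x < row i ⇔ s * suc x + r * i ≤ k
  row-spec i x = subst (λ n → x < n ⇔ s * suc x + r * i ≤ k) (sym (count-map _ suc (upTo k)))
    (mk⇔ (≤ᵇ⇒≤ (s * suc x + r * i) k) ≤⇒≤ᵇ ⇔-∘ count-upTo-downClosed k P closed bounded x)
    where
    P : ℕ → Bool
    P j = s * suc j + r * i ≤ᵇ k
    closed : DownClosed P
    closed j Pj = ≤⇒≤ᵇ (≤-trans (+-monoˡ-≤ (r * i) (*-monoʳ-≤ s (n≤1+n (suc j)))) (≤ᵇ⇒≤ _ _ Pj))
    bounded : ∀ {j} → T (P j) → j < k
    bounded {j} Pj = ≤-trans (m≤n*m (suc j) s {{>-nonZero s>0}})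
                             (≤-trans (m≤m+n (s * suc j) (r * i)) (≤ᵇ⇒≤ _ _ Pj))

  row-antitone : ∀ i → row (suc i) ≤ row i
  row-antitone i = ∀<⇒≤ λ {x} x< → from (row-spec i x)
    (≤-trans (+-monoʳ-≤ (s * suc x) (*-monoʳ-≤ r (n≤1+n i))) (to (row-spec (suc i) x) x<))

  row-vanish : ∀ {y} → k ≤ y → row (suc y) ≡ 0
  row-vanish {y} k≤y = n≤0⇒n≡0 (∀<⇒≤ λ {x} x< → ⊥-elim (<-irrefl refl (≤-trans (s≤s k≤y)
    (≤-trans (m≤n*m (suc y) r {{>-nonZero r>0}})
             (≤-trans (m≤n+m (r * suc y) (s * suc x)) (to (row-spec (suc y) x) x<))))))

  lam-spec : ∀ y x → x < part (lam r s k) y ⇔ s * suc x + r * suc y ≤ k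
  lam-spec y x = subst (λ n → x < n ⇔ s * suc x + r * suc y ≤ k) (sym part-lam) (row-spec (suc y) x)
    where
    open ≡-Reasoning
    rows : List ℕ
    rows = applyUpTo (row ∘ suc) k
    part-lam : part (lam r s k) y ≡ row (suc y)
    part-lam = begin
      part (lam r s k) y                    ≡⟨ cong (λ xs → part (filter (λ n → 1 ≤? n) xs) y)
                                                    (trans (sym (map-∘ (upTo k))) (map-upTo (row ∘ suc) k)) ⟩
      part (filter (λ n → 1 ≤? n) rows) y   ≡⟨ part-filter-positive (applyUpTo⁺₂ _ k (row-antitone ∘ suc)) y ⟩
      part rows y                           ≡⟨ part-applyUpTo (row ∘ suc) k row-vanish y ⟩
      row (suc y)                           ∎

  lam-positive : All (0 <_) (lam r s k)
  lam-positive = all-filter (λ n → 1 ≤? n) (map row (oneTo k))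

  lam-eastE : ∀ {x y} → T (eastE (lam r s k) x y) → k < s * suc x + r * suc y
  lam-eastE {x} {y} e = ≰⇒> λ inside →
    <-irrefl refl (≤-trans (from (lam-spec y x) inside) (eastE⇒part≤ (lam r s k) y e))

  lam-southE : ∀ {x y} → T (southE (lam r s k) (suc x) y) → s * suc x + r * suc y ≤ k
  lam-southE {x} {y} e = to (lam-spec y x) (≤-reflexive (sym (≡ᵇ⇒≡ _ _ e)))

≡ᴷ-refl : ∀ K → T (K ≡ᴷ K)
≡ᴷ-refl (a , b) = from T-∧ (≡⇒≡ᵇ a a refl , ≡⇒≡ᵇ b b refl)

≡ᴷ⇒≡ : ∀ K K' → T (K ≡ᴷ K') → K ≡ K'
≡ᴷ⇒≡ (a , b) (a' , b') eq = let a≡ , b≡ = to T-∧ eq in cong₂ _,_ (≡ᵇ⇒≡ a a' a≡) (≡ᵇ⇒≡ b b' b≡)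

box-cartesian : ∀ v → box v ≡ cartesianProduct (upTo (suc v)) (upTo (suc v))
box-cartesian v = pairs (upTo (suc v))
  where
  pairs : ∀ xs → concatMap (λ x → map (x ,_) (upTo (suc v))) xs ≡ cartesianProduct xs (upTo (suc v))
  pairs []       = refl
  pairs (x ∷ xs) = cong (map (x ,_) (upTo (suc v)) ++_) (pairs xs)

box-unique : ∀ v → Unique (box v)
box-unique v rewrite box-cartesian v = Unique.cartesianProduct⁺ (Unique.upTo⁺ (suc v)) (Unique.upTo⁺ (suc v))

∈-box : ∀ {x y v} → x ≤ v → y ≤ v → (x , y) ∈ box v
∈-box {v = v} x≤v y≤v rewrite box-cartesian v = ∈-cartesianProduct⁺ (∈-upTo⁺ (s≤s x≤v)) (∈-upTo⁺ (s≤s y≤v))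

module Edges (r s c : ℕ) .{{_ : NonZero c}} (r>0 : 0 < r) (s>0 : 0 < s) where

  level : ℕ → ℕ → ℕ
  level x y = s * x + r * y

  ∈-box-level : ∀ {x y v} → level x y ≤ v → (x , y) ∈ box v
  ∈-box-level {x} {y} ≤v =
    ∈-box (≤-trans (m≤n*m x s {{>-nonZero s>0}}) (≤-trans (m≤m+n (s * x) (r * y)) ≤v))
          (≤-trans (m≤n*m y r {{>-nonZero r>0}}) (≤-trans (m≤n+m (r * y) (s * x)) ≤v))

  ∈-box-source : ∀ {x y} → (x , y) ∈ box (level x (suc y))
  ∈-box-source {x} {y} = ∈-box-level (+-monoʳ-≤ (s * x) (*-monoʳ-≤ r (n≤1+n y)))

  eastInto : List ℕ → Key → Key → ℕ × ℕ → Bool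
  eastInto ν K₁ K₂ (x , y) = eastE ν x y ∧ (key r s c x y ≡ᴷ K₁) ∧ (key r s c (suc x) y ≡ᴷ K₂)

  southInto : List ℕ → Key → Key → ℕ × ℕ → Bool
  southInto ν K₁ K₂ (x , y) = southE ν x y ∧ (key r s c x (suc y) ≡ᴷ K₁) ∧ (key r s c x y ≡ᴷ K₂)

  SameEast SameSouth : List ℕ → List ℕ → Set
  SameEast  μ ν = ∀ K₁ K₂ → eastCount r s c μ K₁ K₂ ≡ eastCount r s c ν K₁ K₂
  SameSouth μ ν = ∀ K₁ K₂ → southCount r s c μ K₁ K₂ ≡ southCount r s c ν K₁ K₂

  eastInto⇒ : ∀ ν K₁ K₂ x y → T (eastInto ν K₁ K₂ (x , y)) →
              T (eastE ν x y) × key r s c x y ≡ K₁ × key r s c (suc x) y ≡ K₂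
  eastInto⇒ ν K₁ K₂ x y e =
    let E , k₁₂ = to (T-∧ {eastE ν x y}) e
        k₁ , k₂ = to (T-∧ {key r s c x y ≡ᴷ K₁}) k₁₂
    in E , ≡ᴷ⇒≡ _ K₁ k₁ , ≡ᴷ⇒≡ _ K₂ k₂

  eastInto-own : ∀ ν x y → T (eastE ν x y) → T (eastInto ν (key r s c x y) (key r s c (suc x) y) (x , y))
  eastInto-own ν x y E = from (T-∧ {eastE ν x y}) (E , from (T-∧ {key r s c x y ≡ᴷ _})
                           (≡ᴷ-refl (key r s c x y) , ≡ᴷ-refl (key r s c (suc x) y)))

  southInto⇒ : ∀ ν K₁ K₂ x y → T (southInto ν K₁ K₂ (x , y)) →
               T (southE ν x y) × key r s c x (suc y) ≡ K₁ × key r s c x y ≡ K₂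
  southInto⇒ ν K₁ K₂ x y e =
    let S , k₁₂ = to (T-∧ {southE ν x y}) e
        k₁ , k₂ = to (T-∧ {key r s c x (suc y) ≡ᴷ K₁}) k₁₂
    in S , ≡ᴷ⇒≡ _ K₁ k₁ , ≡ᴷ⇒≡ _ K₂ k₂

  southInto-own : ∀ ν x y → T (southE ν x y) → T (southInto ν (key r s c x (suc y)) (key r s c x y) (x , y))
  southInto-own ν x y S = from (T-∧ {southE ν x y}) (S , from (T-∧ {key r s c x (suc y) ≡ᴷ _})
                            (≡ᴷ-refl (key r s c x (suc y)) , ≡ᴷ-refl (key r s c x y)))

  southInto-transport : ∀ μ ν K₁ K₂ x y → T (southE μ x y) → T (southInto ν K₁ K₂ (x , y)) →
                        T (southInto μ K₁ K₂ (x , y))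
  southInto-transport μ ν K₁ K₂ x y S e = from (T-∧ {southE μ x y}) (S , proj₂ (to (T-∧ {southE ν x y}) e))

  east-transfer : ∀ {μ ν} → SameEast μ ν → ∀ {x y} → T (eastE μ x y) →
                  ∃₂ λ x' y' → T (eastE ν x' y') × level x' y' ≡ level x y
  east-transfer {μ} {ν} same {x} {y} E
    with (x' , y') , _ , e ← count-witness (eastInto ν _ _) (box (level x y))
           (subst (1 ≤_) (same _ _) (count-≥1 (eastInto μ _ _) (∈-box-level ≤-refl) (eastInto-own μ x y E)))
    = let E' , k₁ , _ = eastInto⇒ ν _ _ x' y' e in x' , y' , E' , cong proj₁ k₁

  south-transfer : ∀ {μ ν} → SameSouth μ ν → ∀ {x y} → T (southE μ x y) →
                   let K₁ = key r s c x (suc y) ; K₂ = key r s c x y in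
                   ∃[ e ] e ∈ box (level x (suc y)) × T (southInto ν K₁ K₂ e)
  south-transfer {μ} {ν} same {x} {y} S =
    count-witness (southInto ν _ _) (box (level x (suc y)))
      (subst (1 ≤_) (same _ _) (count-≥1 (southInto μ _ _) ∈-box-source (southInto-own μ x y S)))

suc-level : ∀ s r x y → s * suc x + r * suc y ≡ (s * x + r * y) + (s + r)
suc-level = solve-∀

module Rigidity (r s c k : ℕ) .{{_ : NonZero c}} (r>0 : 0 < r) (s>0 : 0 < s) where

  open Staircase r s k r>0 s>0
  open Edges r s c r>0 s>0

  L : List ℕ
  L = lam r s k

  -- the box with top-right corner (x + 1, y + 1); it belongs to μ iff x < part μ y
  corner : ℕ → ℕ → ℕ
  corner x y = level (suc x) (suc y)

  lam-high-southE-on-axis : ∀ {K₁ K₂} x y → k < proj₁ K₁ → T (southInto L K₁ K₂ (x , y)) →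
                            x ≡ 0 × level x (suc y) ≡ proj₁ K₁
  lam-high-southE-on-axis {K₁} {K₂} x y high e with southInto⇒ L K₁ K₂ x y e
  lam-high-southE-on-axis zero    y high e | _ , k₁ , _ = refl , cong proj₁ k₁
  lam-high-southE-on-axis (suc x) y high e | S , k₁ , _ =
    ⊥-elim (<⇒≱ high (subst (_≤ k) (cong proj₁ k₁) (lam-southE S)))

  lam-southCount≤1 : ∀ K₁ K₂ → k < proj₁ K₁ → southCount r s c L K₁ K₂ ≤ 1
  lam-southCount≤1 K₁ K₂ high = count-≤1 (southInto L K₁ K₂) (box-unique (proj₁ K₁)) same-point
    where
    same-point : ∀ {e e'} → e ∈ box (proj₁ K₁) → e' ∈ box (proj₁ K₁) →
                 T (southInto L K₁ K₂ e) → T (southInto L K₁ K₂ e') → e ≡ e'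
    same-point {x , y} {x' , y'} _ _ e e'
      with lam-high-southE-on-axis x y high e | lam-high-southE-on-axis x' y' high e'
    ... | refl , lvl | refl , lvl' = cong (0 ,_) (suc-injective
          (*-cancelˡ-≡ (suc y) (suc y') r {{>-nonZero r>0}} (+-cancelˡ-≡ (s * 0) _ _ (trans lvl (sym lvl')))))

  module _ {μ : List ℕ} (μ⁺ : All (0 <_) μ) (μ↓ : Linked (flip _≤_) μ)
           (sameS : SameSouth μ L) (sameE : SameEast μ L) where

    outside : ∀ {x y} → part μ y ≤ x → k < corner x y
    outside {x} {y} part≤x =
      let y' , y'≤y , e = east-edge-at-or-above μ y part≤x
          x'' , y'' , e' , lvl = east-transfer {μ} {L} sameE e
      in begin-strict
        k                         <⟨ lam-eastE e' ⟩
        corner x'' y''            ≡⟨ suc-level s r x'' y'' ⟩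
        level x'' y'' + (s + r)   ≡⟨ cong (_+ (s + r)) lvl ⟩
        level x y' + (s + r)      ≡⟨ sym (suc-level s r x y') ⟩
        corner x y'               ≤⟨ +-monoʳ-≤ (s * suc x) (*-monoʳ-≤ r (s≤s y'≤y)) ⟩
        corner x y                ∎
      where open ≤-Reasoning

    lam⊆μ : ∀ y → part L y ≤ part μ y
    lam⊆μ y = ∀<⇒≤ λ {x} x< → ≰⇒> λ part≤x → <⇒≱ (outside part≤x) (to (lam-spec y x) x<)

    row-end-ascent : ∀ {x y} → part μ y ≡ suc x → k < corner x y →
                     ∃[ y' ] 0 < part μ y' × corner x y < corner 0 y'
    row-end-ascent {x} {y} end high with south-transfer {μ} {L} sameS {suc x} {y} (≡⇒≡ᵇ _ _ end)
    ... | (x' , y') , e∈ , e with lam-high-southE-on-axis x' y' high e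
    ... | refl , lvl with length μ ≤? y'
    ... | no within = y' , <length⇒part-pos μ⁺ (≰⇒> within) ,
      subst (_< corner 0 y') lvl (+-monoˡ-< (r * suc y') (*-monoʳ-< s {{>-nonZero s>0}} z<s))
    ... | yes beyond = ⊥-elim (<⇒≱ two-in-μ (begin
      southCount r s c μ K₁ K₂ ≡⟨ sameS K₁ K₂ ⟩
      southCount r s c L K₁ K₂ ≤⟨ lam-southCount≤1 K₁ K₂ high ⟩
      1                        ∎))
      where
      open ≤-Reasoning
      K₁ = key r s c (suc x) (suc y)
      K₂ = key r s c (suc x) y
      two-in-μ : 2 ≤ southCount r s c μ K₁ K₂
      two-in-μ = count-≥2 (southInto μ K₁ K₂) ∈-box-source e∈ (λ ())
        (southInto-own μ (suc x) y (≡⇒≡ᵇ _ _ end)) (southInto-transport μ L K₁ K₂ 0 y' (≤⇒≤ᵇ beyond) e)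

    HighBox : ℕ × ℕ → Set
    HighBox (x , y) = x < part μ y × k < corner x y

    higher-box : ∀ {b} → HighBox b → ∃[ b' ] HighBox b' × uncurry corner b < uncurry corner b'
    higher-box {x , y} (x<part , high) with suc x <? part μ y
    ... | yes x+1<part = (suc x , y) , (x+1<part , <-trans high step) , step
      where
      step : corner x y < corner (suc x) y
      step = +-monoˡ-< (r * suc y) (*-monoʳ-< s {{>-nonZero s>0}} (n<1+n (suc x)))
    ... | no x+1≮part =
      let y' , pos , step = row-end-ascent (≤-antisym (≮⇒≥ x+1≮part) x<part) high
      in (0 , y') , (pos , <-trans high step) , step

    highBox-bounded : ∀ {b} → HighBox b → uncurry corner b ≤ s * part μ 0 + r * length μ
    highBox-bounded {x , y} (x<part , _) =
      +-mono-≤ (*-monoʳ-≤ s (≤-trans x<part (part-≤-head μ↓ y)))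
               (*-monoʳ-≤ r (part-pos⇒<length μ (≤-trans (s≤s z≤n) x<part)))

    μ⊆lam : ∀ {x y} → x < part μ y → corner x y ≤ k
    μ⊆lam x<part = ≮⇒≥ λ high →
      no-endless-ascent HighBox (uncurry corner) _ highBox-bounded higher-box (x<part , high)

    μ≡lam : μ ≡ L
    μ≡lam = part-injective μ⁺ lam-positive λ y →
      ≤-antisym (∀<⇒≤ λ {x} x< → from (lam-spec y x) (μ⊆lam x<)) (lam⊆μ y)

SameM⇒≡lam : ∀ r s c k .{{_ : NonZero c}} → 0 < r → 0 < s →
             ∀ {μ} → IsPartition μ → SameM r s c μ (lam r s k) → μ ≡ lam r s k
SameM⇒≡lam r s c k r>0 s>0 (μ⁺ , μ↓) (_ , sameS , sameE) =
  Rigidity.μ≡lam r s c k r>0 s>0 μ⁺ μ↓ sameS sameE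

proposition4p18 : (r s c k₁ k : ℕ) .{{_ : NonZero c}} →
    0 < r → 0 < s → Coprime r s → 0 < k₁ → c ∣ k₁ → k ≡ r * s * k₁ →
    (μ : List ℕ) → IsPartition μ →
    SameM r s c μ (lam r s k) → μ ≡ lam r s k
proposition4p18 r s c _ k r>0 s>0 _ _ _ _ μ = SameM⇒≡lam r s c k r>0 s>0
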